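{- For all $n\ge1$, $3\nmid E_n$.
   Context: $E_n$ denotes the $n$-th Euler (up/down) number, defined by $\sum_{n\ge0}E_n\frac{x^n}{n!}=\sec x+\tan x$; equivalently $E_n$ is the number of linear extensions of the zigzag poset on $n$ elements $z_1<z_2>z_3<z_4>\cdots$. -}

module Defs where

open import Data.Nat using (ℕ; zero; suc; _<_; _>_; _<ᵇ_)
open import Data.Bool using (Bool; true; false; _∧_)
open import Data.List using (List; []; _∷_; length; filterᵇ; concatMap; map; upTo)

insertions : ℕ → List ℕ → List (List ℕ)
insertions x [] = (x ∷ []) ∷ []
insertions x (y ∷ ys) = (x ∷ y ∷ ys) ∷ map (y ∷_) (insertions x ys)

perms : List ℕ → List (List ℕ)
perms [] = [] ∷ []
perms (x ∷ xs) = concatMap (insertions x) (perms xs)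

-- A labelling (a₁, a₂, …, aₙ) of the zigzag poset z₁ < z₂ > z₃ < z₄ > ⋯
-- respects the order iff a₁ < a₂ > a₃ < a₄ > ⋯ .
-- upStep b l : the next comparison should be an ascent (b = true) or descent.
zigzag : Bool → List ℕ → Bool
zigzag b [] = true
zigzag b (x ∷ []) = true
zigzag true  (x ∷ y ∷ ys) = (x <ᵇ y) ∧ zigzag false (y ∷ ys)
zigzag false (x ∷ y ∷ ys) = (y <ᵇ x) ∧ zigzag true (y ∷ ys)

linearExtensions : ℕ → List (List ℕ)
linearExtensions n = filterᵇ (zigzag true) (perms (upTo n))

E : ℕ → ℕ
E n = length (linearExtensions n)

{-# OPTIONS --safe #-}
module Submission where

-- As perms constructs them, the permutations of 0, …, n-1 arise by
-- inserting each letter as a new minimum into the permutations of the larger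
-- letters. Weight a sequence, read after a sentinel larger than all its
-- letters, by an element of the free 𝔽₃[z]/(z³)-module on 1 and ρ. The
-- constant term of the weight is 1 exactly for zigzag sequences, and summing
-- the weights over all ways of inserting a new minimum turns a weight w into
-- ∂ w, for an operator ∂ obeying the Leibniz rule for multiplication by z.
-- Hence E n is congruent mod 3 to the constant term of ∂ⁿ (1 + ρ), and for
-- n ≥ 1 these constant terms run periodically through 1, 1, 2, 2.

open import Defs
open import Data.Nat using (ℕ; _≥_)
open import Data.Nat.Divisibility using (_∣_)
open import Relation.Nullary using (¬_)

open import Algebra using (CommutativeSemigroup; isCommutativeMonoidˡ)
open import Algebra.Core using (Op₂)
open import Algebra.Structures using (IsCommutativeMonoid)
import Algebra.Properties.CommutativeSemigroup as CommutativeSemigroupProperties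
open import Data.Bool using (Bool; true; false; _∧_)
open import Data.List using (List; []; _∷_; _++_; map; concatMap; length; filterᵇ; upTo)
open import Data.List.Properties using (length-upTo)
open import Data.List.Relation.Unary.All as All using (All; []; _∷_)
open import Data.List.Relation.Unary.All.Properties using (map⁺; concat⁺; all-upTo)
open import Data.List.Relation.Unary.AllPairs using (AllPairs; []; _∷_)
open import Data.List.Relation.Unary.AllPairs.Properties using (applyUpTo⁺₁)
open import Data.Nat using (zero; suc; _<_; _<ᵇ_; _*_)
open import Data.Nat.Divisibility using (divides)
open import Data.Nat.GeneralisedArithmetic using (fold; iterate; iterate-is-fold)
open import Data.Nat.Properties using (_<?_; <⇒≯)
open import Data.Product using (_,_; _×_; zip′)
open import Function using (_∘_; id)
open import Level using (0ℓ)
open import Relation.Binary.PropositionalEquality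
  using (_≡_; _≢_; refl; sym; trans; cong; cong₂; module ≡-Reasoning)
open import Relation.Binary.PropositionalEquality.Algebra using (isMagma)
open import Relation.Nullary.Decidable using (dec-true; dec-false)

open ≡-Reasoning

<ᵇ-true : ∀ {m n} → m < n → (m <ᵇ n) ≡ true
<ᵇ-true {m} {n} = dec-true (m <? n)

<ᵇ-false : ∀ {m n} → m < n → (n <ᵇ m) ≡ false
<ᵇ-false {m} {n} m<n = dec-false (n <? m) (<⇒≯ m<n)

×-isCommutativeMonoid : ∀ {A B : Set} {_∙_ : Op₂ A} {_∘_ : Op₂ B} {ε : A} {ε′ : B} →
                        IsCommutativeMonoid _≡_ _∙_ ε → IsCommutativeMonoid _≡_ _∘_ ε′ →
                        IsCommutativeMonoid _≡_ (zip′ _∙_ _∘_) (ε , ε′)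
×-isCommutativeMonoid {_∙_ = _∙_} {_∘_} P Q = isCommutativeMonoidˡ record
  { isSemigroup = record
    { isMagma = isMagma (zip′ _∙_ _∘_)
    ; assoc   = λ (a , b) (c , d) (e , f) → cong₂ _,_ (P.assoc a c e) (Q.assoc b d f)
    }
  ; identityˡ = λ (a , b) → cong₂ _,_ (P.identityˡ a) (Q.identityˡ b)
  ; comm      = λ (a , b) (c , d) → cong₂ _,_ (P.comm a c) (Q.comm b d)
  }
  where module P = IsCommutativeMonoid P
        module Q = IsCommutativeMonoid Q

module ≡-CommutativeMonoid {C : Set} {_+_ : Op₂ C} {0# : C}
                           (isCM : IsCommutativeMonoid _≡_ _+_ 0#) where

  open IsCommutativeMonoid isCM public using (assoc; identityˡ; identityʳ)

  private
    commutativeSemigroup : CommutativeSemigroup 0ℓ 0ℓ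
    commutativeSemigroup = record
      { isCommutativeSemigroup = IsCommutativeMonoid.isCommutativeSemigroup isCM }

  open CommutativeSemigroupProperties commutativeSemigroup public
    using (interchange; x∙yz≈y∙xz)

  ∑ : {X : Set} → List X → (X → C) → C
  ∑ []       f = 0#
  ∑ (x ∷ xs) f = f x + ∑ xs f

  module _ {X : Set} where

    ∑-++ : ∀ (xs ys : List X) f → ∑ (xs ++ ys) f ≡ ∑ xs f + ∑ ys f
    ∑-++ []       ys f = sym (identityˡ (∑ ys f))
    ∑-++ (x ∷ xs) ys f = trans (cong (f x +_) (∑-++ xs ys f)) (sym (assoc (f x) _ _))

    ∑-map : ∀ {Y : Set} (g : Y → X) ys f → ∑ (map g ys) f ≡ ∑ ys (f ∘ g)
    ∑-map g []       f = refl
    ∑-map g (y ∷ ys) f = cong (f (g y) +_) (∑-map g ys f)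

    ∑-concatMap : ∀ {Y : Set} (g : Y → List X) ys f →
                  ∑ (concatMap g ys) f ≡ ∑ ys (λ y → ∑ (g y) f)
    ∑-concatMap g []       f = refl
    ∑-concatMap g (y ∷ ys) f =
      trans (∑-++ (g y) (concatMap g ys) f) (cong (∑ (g y) f +_) (∑-concatMap g ys f))

    ∑-+ : ∀ (xs : List X) f g → ∑ xs (λ x → f x + g x) ≡ ∑ xs f + ∑ xs g
    ∑-+ []       f g = sym (identityˡ 0#)
    ∑-+ (x ∷ xs) f g =
      trans (cong ((f x + g x) +_) (∑-+ xs f g)) (interchange (f x) (g x) (∑ xs f) (∑ xs g))

    ∑-hom : (φ : C → C) → (∀ a b → φ (a + b) ≡ φ a + φ b) → φ 0# ≡ 0# →
            ∀ (xs : List X) f → ∑ xs (φ ∘ f) ≡ φ (∑ xs f)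
    ∑-hom φ φ-+ φ-0 []       f = sym φ-0
    ∑-hom φ φ-+ φ-0 (x ∷ xs) f =
      trans (cong (φ (f x) +_) (∑-hom φ φ-+ φ-0 xs f)) (sym (φ-+ (f x) (∑ xs f)))

    ∑-cong : ∀ {xs : List X} {f g} → All (λ x → f x ≡ g x) xs → ∑ xs f ≡ ∑ xs g
    ∑-cong []         = refl
    ∑-cong (fx ∷ fxs) = cong₂ _+_ fx (∑-cong fxs)

data 𝔽₃ : Set where
  0₃ 1₃ 2₃ : 𝔽₃

infixl 6 _+₃_
_+₃_ : Op₂ 𝔽₃
0₃ +₃ y  = y
1₃ +₃ 0₃ = 1₃
1₃ +₃ 1₃ = 2₃
1₃ +₃ 2₃ = 0₃
2₃ +₃ 0₃ = 2₃
2₃ +₃ 1₃ = 0₃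
2₃ +₃ 2₃ = 1₃

+₃-assoc : ∀ x y z → (x +₃ y) +₃ z ≡ x +₃ (y +₃ z)
+₃-assoc 0₃ y  z  = refl
+₃-assoc 1₃ 0₃ z  = refl
+₃-assoc 1₃ 1₃ 0₃ = refl
+₃-assoc 1₃ 1₃ 1₃ = refl
+₃-assoc 1₃ 1₃ 2₃ = refl
+₃-assoc 1₃ 2₃ 0₃ = refl
+₃-assoc 1₃ 2₃ 1₃ = refl
+₃-assoc 1₃ 2₃ 2₃ = refl
+₃-assoc 2₃ 0₃ z  = refl
+₃-assoc 2₃ 1₃ 0₃ = refl
+₃-assoc 2₃ 1₃ 1₃ = refl
+₃-assoc 2₃ 1₃ 2₃ = refl
+₃-assoc 2₃ 2₃ 0₃ = refl
+₃-assoc 2₃ 2₃ 1₃ = refl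
+₃-assoc 2₃ 2₃ 2₃ = refl

+₃-comm : ∀ x y → x +₃ y ≡ y +₃ x
+₃-comm 0₃ 0₃ = refl
+₃-comm 0₃ 1₃ = refl
+₃-comm 0₃ 2₃ = refl
+₃-comm 1₃ 0₃ = refl
+₃-comm 1₃ 1₃ = refl
+₃-comm 1₃ 2₃ = refl
+₃-comm 2₃ 0₃ = refl
+₃-comm 2₃ 1₃ = refl
+₃-comm 2₃ 2₃ = refl

x+[x+x]≡0 : ∀ x → x +₃ (x +₃ x) ≡ 0₃
x+[x+x]≡0 0₃ = refl
x+[x+x]≡0 1₃ = refl
x+[x+x]≡0 2₃ = refl

+₃-isCommutativeMonoid : IsCommutativeMonoid _≡_ _+₃_ 0₃
+₃-isCommutativeMonoid = isCommutativeMonoidˡ record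
  { isSemigroup = record { isMagma = isMagma _+₃_ ; assoc = +₃-assoc }
  ; identityˡ   = λ _ → refl
  ; comm        = +₃-comm
  }

module +₃ = ≡-CommutativeMonoid +₃-isCommutativeMonoid

x+y+[x+x]≡y : ∀ x y → (x +₃ y) +₃ (x +₃ x) ≡ y
x+y+[x+x]≡y x y = begin
  (x +₃ y) +₃ (x +₃ x) ≡⟨ cong (_+₃ (x +₃ x)) (+₃-comm x y) ⟩
  (y +₃ x) +₃ (x +₃ x) ≡⟨ +₃-assoc y x (x +₃ x) ⟩
  y +₃ (x +₃ (x +₃ x)) ≡⟨ cong (y +₃_) (x+[x+x]≡0 x) ⟩
  y +₃ 0₃              ≡⟨ +₃.identityʳ y ⟩
  y                    ∎

[_]₃ : ℕ → 𝔽₃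
[ zero  ]₃ = 0₃
[ suc n ]₃ = 1₃ +₃ [ n ]₃

[q*3]₃≡0 : ∀ q → [ q * 3 ]₃ ≡ 0₃
[q*3]₃≡0 zero    = refl
[q*3]₃≡0 (suc q) = begin
  1₃ +₃ (1₃ +₃ (1₃ +₃ [ q * 3 ]₃)) ≡⟨ +₃-assoc 1₃ 1₃ (1₃ +₃ [ q * 3 ]₃) ⟨
  2₃ +₃ (1₃ +₃ [ q * 3 ]₃)         ≡⟨ +₃-assoc 2₃ 1₃ [ q * 3 ]₃ ⟨
  [ q * 3 ]₃                       ≡⟨ [q*3]₃≡0 q ⟩
  0₃                               ∎

⟦_⟧ : Bool → 𝔽₃
⟦ true  ⟧ = 1₃
⟦ false ⟧ = 0₃

-- (a , b , c) stands for a + b z + c z².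
R : Set
R = 𝔽₃ × 𝔽₃ × 𝔽₃

infixl 6 _+ᴿ_
_+ᴿ_ : Op₂ R
_+ᴿ_ = zip′ _+₃_ (zip′ _+₃_ _+₃_)

0ᴿ 1ᴿ : R
0ᴿ = 0₃ , 0₃ , 0₃
1ᴿ = 1₃ , 0₃ , 0₃

+ᴿ-isCommutativeMonoid : IsCommutativeMonoid _≡_ _+ᴿ_ 0ᴿ
+ᴿ-isCommutativeMonoid = ×-isCommutativeMonoid +₃-isCommutativeMonoid
  (×-isCommutativeMonoid +₃-isCommutativeMonoid +₃-isCommutativeMonoid)

module +ᴿ = ≡-CommutativeMonoid +ᴿ-isCommutativeMonoid

z·ᴿ_ : R → R
z·ᴿ (a , b , _) = 0₃ , a , b

-- ∂ z = 1 + z², the equation of tan; it is compatible with z³ = 0 because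
-- ∂ (z³) = 3 z² (1 + z²) vanishes over 𝔽₃.
∂ᴿ : R → R
∂ᴿ (_ , b , c) = b , c +₃ c , b

∂ᴿ-+ : ∀ u v → ∂ᴿ (u +ᴿ v) ≡ ∂ᴿ u +ᴿ ∂ᴿ v
∂ᴿ-+ (_ , b , c) (_ , b′ , c′) =
  cong (λ m → b +₃ b′ , m , b +₃ b′) (+₃.interchange c c′ c c′)

∂ᴿ-z· : ∀ u → ∂ᴿ (z·ᴿ u) ≡ (u +ᴿ z·ᴿ z·ᴿ u) +ᴿ z·ᴿ ∂ᴿ u
∂ᴿ-z· (a , b , c) = sym (cong₂ _,_
  (trans (+₃.identityʳ _) (+₃.identityʳ a))
  (cong₂ _,_ (cong (_+₃ b) (+₃.identityʳ b)) (x+y+[x+x]≡y c a)))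

-- (u , v) stands for u + v ρ.
M : Set
M = R × R

infixl 6 _+_
_+_ : Op₂ M
_+_ = zip′ _+ᴿ_ _+ᴿ_

0# 1# ρ : M
0# = 0ᴿ , 0ᴿ
1# = 1ᴿ , 0ᴿ
ρ  = 0ᴿ , 1ᴿ

+-isCommutativeMonoid : IsCommutativeMonoid _≡_ _+_ 0#
+-isCommutativeMonoid = ×-isCommutativeMonoid +ᴿ-isCommutativeMonoid +ᴿ-isCommutativeMonoid

open ≡-CommutativeMonoid +-isCommutativeMonoid

z·_ : M → M
z· (u , v) = z·ᴿ u , z·ᴿ v

-- ∂ ρ = 1 + z + z ρ, as forced by inserting a minimum after a one-letter
-- sequence (the second clause of ∑-insertions).
∂ : M → M
∂ (u , v) = ∂ᴿ u +ᴿ (v +ᴿ z·ᴿ v) , ∂ᴿ v +ᴿ z·ᴿ v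

infixr 7 _·_
_·_ : Bool → M → M
true  · x = x
false · x = 0#

constantTerm : M → 𝔽₃
constantTerm ((a , _) , _) = a

·-+ : ∀ b x y → b · (x + y) ≡ b · x + b · y
·-+ true  x y = refl
·-+ false x y = refl

·-0 : ∀ b → b · 0# ≡ 0#
·-0 true  = refl
·-0 false = refl

∂-· : ∀ b x → ∂ (b · x) ≡ b · ∂ x
∂-· true  x = refl
∂-· false x = refl

∂-+ : ∀ x y → ∂ (x + y) ≡ ∂ x + ∂ y
∂-+ (u , v) (u′ , v′) = cong₂ _,_
  (trans (cong₂ _+ᴿ_ (∂ᴿ-+ u u′) (+ᴿ.interchange v v′ (z·ᴿ v) (z·ᴿ v′)))
         (+ᴿ.interchange (∂ᴿ u) (∂ᴿ u′) _ _))
  (trans (cong (_+ᴿ z·ᴿ (v +ᴿ v′)) (∂ᴿ-+ v v′))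
         (+ᴿ.interchange (∂ᴿ v) (∂ᴿ v′) (z·ᴿ v) (z·ᴿ v′)))

∂-z· : ∀ x → ∂ (z· x) ≡ (x + z· z· x) + z· ∂ x
∂-z· (u , v) = cong₂ _,_
  (trans (cong (_+ᴿ (z·ᴿ v +ᴿ z·ᴿ z·ᴿ v)) (∂ᴿ-z· u))
         (+ᴿ.assoc (u +ᴿ z·ᴿ z·ᴿ u) (z·ᴿ ∂ᴿ u) (z·ᴿ v +ᴿ z·ᴿ z·ᴿ v)))
  (trans (cong (_+ᴿ z·ᴿ z·ᴿ v) (∂ᴿ-z· v))
         (+ᴿ.assoc (v +ᴿ z·ᴿ z·ᴿ v) (z·ᴿ ∂ᴿ v) (z·ᴿ z·ᴿ v)))

constantTerm-· : ∀ b {x c} → constantTerm x ≡ ⟦ c ⟧ → constantTerm (b · x) ≡ ⟦ b ∧ c ⟧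
constantTerm-· true  eq = eq
constantTerm-· false eq = refl

-- weight b p r reads p ∷ r from left to right, b telling whether the next
-- step must be an ascent. A required ascent must be present; a required
-- descent may instead be left open for a factor z, a descent being required
-- again afterwards (later minima fill the gap); ending while a descent is
-- required adds the term ρ (later minima may be appended).
weight : Bool → ℕ → List ℕ → M
weight true  p []      = 1#
weight false p []      = 1# + ρ
weight true  p (q ∷ r) = (p <ᵇ q) · weight false q r
weight false p (q ∷ r) = (q <ᵇ p) · weight true q r + z· weight false q r

constantTerm-weight : ∀ b p r → constantTerm (weight b p r) ≡ ⟦ zigzag b (p ∷ r) ⟧
constantTerm-weight true  p []      = refl
constantTerm-weight false p []      = refl
constantTerm-weight true  p (q ∷ r) = constantTerm-· (p <ᵇ q) (constantTerm-weight false q r)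
constantTerm-weight false p (q ∷ r) =
  trans (+₃.identityʳ _) (constantTerm-· (q <ᵇ p) (constantTerm-weight true q r))

zigzag-after-larger : ∀ {p} σ → All (_< p) σ → zigzag false (p ∷ σ) ≡ zigzag true σ
zigzag-after-larger []      []        = refl
zigzag-after-larger (q ∷ r) (q<p ∷ _) = cong (_∧ zigzag true (q ∷ r)) (<ᵇ-true q<p)

constantTerm-weight-after-larger : ∀ {p} σ → All (_< p) σ →
                                   constantTerm (weight false p σ) ≡ ⟦ zigzag true σ ⟧
constantTerm-weight-after-larger {p} σ σ<p =
  trans (constantTerm-weight false p σ) (cong ⟦_⟧ (zigzag-after-larger σ σ<p))

ascent-to-smaller : ∀ {p x} r → x < p → weight true p (x ∷ r) ≡ 0#
ascent-to-smaller {x = x} r x<p = cong (_· weight false x r) (<ᵇ-false x<p)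

descent-to-smaller : ∀ {p x} r → x < p →
                     weight false p (x ∷ r) ≡ weight true x r + z· weight false x r
descent-to-smaller {x = x} r x<p =
  cong (λ b → b · weight true x r + z· weight false x r) (<ᵇ-true x<p)

ascent-from-smaller : ∀ {x q} r → x < q → weight true x (q ∷ r) ≡ weight false q r
ascent-from-smaller {q = q} r x<q = cong (_· weight false q r) (<ᵇ-true x<q)

descent-from-smaller : ∀ {x q} r → x < q → weight false x (q ∷ r) ≡ z· weight false q r
descent-from-smaller {q = q} r x<q =
  cong (λ b → b · weight true q r + z· weight false q r) (<ᵇ-false x<q)

∑-insertions : ∀ {x p} b r → x < p → All (x <_) r →
               ∑ (insertions x r) (weight b p) ≡ ∂ (weight b p r)
∑-insertions true  [] x<p [] = cong (_+ 0#) (ascent-to-smaller [] x<p)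
∑-insertions false [] x<p [] = cong (_+ 0#) (descent-to-smaller [] x<p)
∑-insertions {x} {p} true (q ∷ r) x<p (x<q ∷ x<r) = begin
  weight true p (x ∷ q ∷ r) + ∑ (map (q ∷_) (insertions x r)) (weight true p)
    ≡⟨ cong₂ _+_ (ascent-to-smaller (q ∷ r) x<p) (∑-map (q ∷_) (insertions x r) _) ⟩
  ∑ (insertions x r) (((p <ᵇ q) ·_) ∘ weight false q)
    ≡⟨ ∑-hom ((p <ᵇ q) ·_) (·-+ (p <ᵇ q)) (·-0 (p <ᵇ q)) (insertions x r) _ ⟩
  (p <ᵇ q) · ∑ (insertions x r) (weight false q)
    ≡⟨ cong ((p <ᵇ q) ·_) (∑-insertions false r x<q x<r) ⟩
  (p <ᵇ q) · ∂ (weight false q r)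
    ≡⟨ ∂-· (p <ᵇ q) (weight false q r) ⟨
  ∂ (weight true p (q ∷ r)) ∎
∑-insertions {x} {p} false (q ∷ r) x<p (x<q ∷ x<r) = begin
  weight false p (x ∷ q ∷ r) + ∑ (map (q ∷_) ins) (weight false p)
    ≡⟨ cong₂ _+_ x-inserted-first (∑-map (q ∷_) ins _) ⟩
  (g + z· z· g) + ∑ ins (λ τ → c · weight true q τ + z· weight false q τ)
    ≡⟨ cong ((g + z· z· g) +_) ∑-tails ⟩
  (g + z· z· g) + (c · ∂ h + z· ∂ g)
    ≡⟨ x∙yz≈y∙xz (g + z· z· g) (c · ∂ h) (z· ∂ g) ⟩
  c · ∂ h + ((g + z· z· g) + z· ∂ g)
    ≡⟨ cong₂ _+_ (∂-· c h) (∂-z· g) ⟨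
  ∂ (c · h) + ∂ (z· g)
    ≡⟨ ∂-+ (c · h) (z· g) ⟨
  ∂ (weight false p (q ∷ r)) ∎
  where
  c = q <ᵇ p
  g = weight false q r
  h = weight true q r
  ins = insertions x r

  x-inserted-first : weight false p (x ∷ q ∷ r) ≡ g + z· z· g
  x-inserted-first = trans (descent-to-smaller (q ∷ r) x<p)
    (cong₂ (λ a b → a + z· b) (ascent-from-smaller r x<q) (descent-from-smaller r x<q))

  ∑-tails : ∑ ins (λ τ → c · weight true q τ + z· weight false q τ) ≡ c · ∂ h + z· ∂ g
  ∑-tails = begin
    ∑ ins (λ τ → c · weight true q τ + z· weight false q τ)
      ≡⟨ ∑-+ ins _ _ ⟩
    ∑ ins ((c ·_) ∘ weight true q) + ∑ ins (z·_ ∘ weight false q)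
      ≡⟨ cong₂ _+_ (∑-hom (c ·_) (·-+ c) (·-0 c) ins _) (∑-hom z·_ (λ _ _ → refl) refl ins _) ⟩
    c · ∑ ins (weight true q) + z· ∑ ins (weight false q)
      ≡⟨ cong₂ (λ a b → c · a + z· b) (∑-insertions true r x<q x<r) (∑-insertions false r x<q x<r) ⟩
    c · ∂ h + z· ∂ g ∎

insertions⁺ : ∀ {P : ℕ → Set} {x} xs → P x → All P xs → All (All P) (insertions x xs)
insertions⁺ []       px []         = (px ∷ []) ∷ []
insertions⁺ (y ∷ ys) px (py ∷ pys) =
  (px ∷ py ∷ pys) ∷ map⁺ (All.map (py ∷_) (insertions⁺ ys px pys))

perms⁺ : ∀ {P : ℕ → Set} {xs} → All P xs → All (All P) (perms xs)
perms⁺ []         = [] ∷ []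
perms⁺ (px ∷ pxs) = concat⁺ (map⁺ (All.map (insertions⁺ _ px) (perms⁺ pxs)))

∑-perms : ∀ {p} xs → AllPairs _<_ xs → All (_< p) xs →
          ∑ (perms xs) (weight false p) ≡ fold (1# + ρ) ∂ (length xs)
∑-perms     []       []             []             = identityʳ (1# + ρ)
∑-perms {p} (y ∷ ys) (y<ys ∷ ys↑) (y<p ∷ ys<p) = begin
  ∑ (concatMap (insertions y) (perms ys)) (weight false p)
    ≡⟨ ∑-concatMap (insertions y) (perms ys) _ ⟩
  ∑ (perms ys) (λ σ → ∑ (insertions y σ) (weight false p))
    ≡⟨ ∑-cong (All.map (λ {σ} → ∑-insertions false σ y<p) (perms⁺ y<ys)) ⟩
  ∑ (perms ys) (∂ ∘ weight false p)
    ≡⟨ ∑-hom ∂ ∂-+ refl (perms ys) _ ⟩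
  ∂ (∑ (perms ys) (weight false p))
    ≡⟨ cong ∂ (∑-perms ys ys↑ ys<p) ⟩
  fold (1# + ρ) ∂ (length (y ∷ ys)) ∎

[length-filterᵇ]₃ : ∀ {X : Set} (f : X → Bool) (w : X → M) {xs} →
                    All (λ x → constantTerm (w x) ≡ ⟦ f x ⟧) xs →
                    [ length (filterᵇ f xs) ]₃ ≡ constantTerm (∑ xs w)
[length-filterᵇ]₃ f w []                  = refl
[length-filterᵇ]₃ f w {x ∷ xs} (wx ∷ wxs) with f x
... | true  = cong₂ _+₃_ (sym wx) ([length-filterᵇ]₃ f w wxs)
... | false = cong₂ _+₃_ (sym wx) ([length-filterᵇ]₃ f w wxs)

E-mod-3 : ∀ n → [ E n ]₃ ≡ constantTerm (iterate ∂ (1# + ρ) n)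
E-mod-3 n = begin
  [ E n ]₃
    ≡⟨ [length-filterᵇ]₃ (zigzag true) (weight false n)
         (All.map (λ {σ} → constantTerm-weight-after-larger σ) (perms⁺ (all-upTo n))) ⟩
  constantTerm (∑ (perms (upTo n)) (weight false n))
    ≡⟨ cong constantTerm (∑-perms (upTo n) (applyUpTo⁺₁ id n (λ i<j _ → i<j)) (all-upTo n)) ⟩
  constantTerm (fold (1# + ρ) ∂ (length (upTo n)))
    ≡⟨ cong (λ k → constantTerm (fold (1# + ρ) ∂ k)) (length-upTo n) ⟩
  constantTerm (fold (1# + ρ) ∂ n)
    ≡⟨ cong constantTerm (iterate-is-fold (1# + ρ) ∂ n) ⟩
  constantTerm (iterate ∂ (1# + ρ) n) ∎

-- ∂² negates ∂ (1 + ρ), so ∂⁴ fixes it and the last clause typechecks by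
-- computation.
constantTerm-∂ⁿ⁺¹-nonzero : ∀ n → constantTerm (iterate ∂ (∂ (1# + ρ)) n) ≢ 0₃
constantTerm-∂ⁿ⁺¹-nonzero 0 ()
constantTerm-∂ⁿ⁺¹-nonzero 1 ()
constantTerm-∂ⁿ⁺¹-nonzero 2 ()
constantTerm-∂ⁿ⁺¹-nonzero 3 ()
constantTerm-∂ⁿ⁺¹-nonzero (suc (suc (suc (suc n)))) = constantTerm-∂ⁿ⁺¹-nonzero n

mainTheorem11 : (n : ℕ) → n ≥ 1 → ¬ (3 ∣ E n)
mainTheorem11 (suc m) _ (divides q E≡q*3) = constantTerm-∂ⁿ⁺¹-nonzero m (begin
  constantTerm (iterate ∂ (∂ (1# + ρ)) m) ≡⟨ E-mod-3 (suc m) ⟨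
  [ E (suc m) ]₃                          ≡⟨ cong [_]₃ E≡q*3 ⟩
  [ q * 3 ]₃                              ≡⟨ [q*3]₃≡0 q ⟩
  0₃                                      ∎)
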